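{- Let $G$ be a finite, simple, connected graph and let $S=(G,\sigma)$ be a parity signed graph. Then the signed graph $S'=(G,\sigma')$ obtained from $S$ by a parity-switch is also a parity signed graph.
   Context: A signed graph $(G,\sigma)$ is a graph $G$ with a map $\sigma:E(G)\to\{1,-1\}$. For $G$ on $n$ vertices, $(G,\sigma)$ is a parity signed graph if there is a bijection $f:V(G)\to\{1,\dots,n\}$ (a parity-labeling) such that for every edge $uv$, $f(u),f(v)$ have the same parity if $\sigma(uv)=1$ and opposite parities if $\sigma(uv)=-1$. Switching at a vertex $v$ negates the sign of every edge incident with $v$. A parity-switch in a parity signed graph is switching (successively) at two vertices $u,v$ whose labels $f(u),f(v)$ under a parity-labeling have opposite parities. -}

module Defs where

open import Data.Nat using (ℕ; suc)
open import Data.Nat.Properties using ()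
open import Data.Bool using (Bool; true; false; not; _xor_; if_then_else_)
open import Data.Fin using (Fin; toℕ; _≟_)
open import Data.Product using (Σ; _×_; _,_; ∃; ∃-syntax)
open import Relation.Nullary using (¬_; Dec; yes; no)
open import Relation.Binary.PropositionalEquality using (_≡_; _≢_)
open import Function.Bundles using (_⤖_; Bijection)
open import Data.Nat using (_%_)

record Graph (n : ℕ) : Set₁ where
  field
    Adj     : Fin n → Fin n → Set
    sym     : ∀ {u v} → Adj u v → Adj v u
    irrefl  : ∀ {u} → ¬ Adj u u
open Graph public

data Reach {n : ℕ} (G : Graph n) : Fin n → Fin n → Set where
  here : ∀ {u} → Reach G u u
  step : ∀ {u v w} → Adj G u v → Reach G v w → Reach G u w

Connected : {n : ℕ} → Graph n → Set
Connected G = ∀ u v → Reach G u v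

-- Signs: true = +1, false = -1.  A signature assigns a sign to each
-- (unordered) edge; we represent it as a function on vertex pairs which is
-- only consulted on edges and required to be symmetric on edges.
Signature : ℕ → Set
Signature n = Fin n → Fin n → Bool

IsSignature : {n : ℕ} → Graph n → Signature n → Set
IsSignature G σ = ∀ {u v} → Adj G u v → σ u v ≡ σ v u

label : {n : ℕ} → Fin n → ℕ
label k = suc (toℕ k)

sameParity : ℕ → ℕ → Bool
sameParity a b with a % 2 Data.Nat.≟ b % 2
... | yes _ = true
... | no  _ = false

IsParityLabeling : {n : ℕ} → Graph n → Signature n → (Fin n ⤖ Fin n) → Set
IsParityLabeling G σ f =
  ∀ {u v} → Adj G u v →
    σ u v ≡ sameParity (label (Bijection.to f u)) (label (Bijection.to f v))

IsParitySigned : {n : ℕ} → Graph n → Signature n → Set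
IsParitySigned G σ = ∃[ f ] IsParityLabeling G σ f

isVertex : {n : ℕ} → Fin n → Fin n → Bool
isVertex x u with x ≟ u
... | yes _ = true
... | no  _ = false

switch : {n : ℕ} → Fin n → Signature n → Signature n
switch x σ u v = (σ u v xor isVertex x u) xor isVertex x v

IsParitySwitchOf : {n : ℕ} → Graph n → Signature n → Signature n → Set
IsParitySwitchOf G σ σ' =
  Σ (Fin _ ⤖ Fin _) λ f → IsParityLabeling G σ f ×
  (∃[ x ] ∃[ y ]
     (sameParity (label (Bijection.to f x)) (label (Bijection.to f y)) ≡ false
      × (∀ {u v} → Adj G u v → σ' u v ≡ switch y (switch x σ) u v)))

-- Let f be a parity-labeling of (G,σ) and x, y vertices whose labels have
-- opposite parities.  Exchanging the labels of x and y changes the parity of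
-- the label of x and of y and of no other vertex.  Hence the parity relation
-- between the two ends of an edge flips exactly when the edge has one end in
-- {x, y} (the edge xy, if present, is flipped twice), and this is precisely
-- the effect of switching at x and then at y.  So f composed with the
-- transposition (x y) is a parity-labeling of the switched signed graph.
module Submission where

open import Defs hiding (sym)
open import Data.Nat using (ℕ; _%_; _≡ᵇ_; _<_; s≤s; z≤n)
import Data.Nat as ℕ
open import Data.Nat.DivMod using (m%n<n)
open import Data.Bool using (Bool; true; false; not; _xor_)
open import Data.Bool.Properties
  using (xor-∧-commutativeRing; xor-assoc; xor-comm; xor-same; xor-identityʳ;
         true-xor; not-distribˡ-xor; not-involutive; not-¬)
open import Algebra.Bundles using (CommutativeRing)
open import Algebra.Properties.CommutativeSemigroup
  (CommutativeRing.+-commutativeSemigroup xor-∧-commutativeRing) using (interchange)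
open import Data.Fin using (Fin)
import Data.Fin as Fin
import Data.Fin.Permutation as Perm
open import Data.Fin.Permutation.Components using (transpose)
open import Data.Product using (_,_)
open import Data.Empty using (⊥-elim)
open import Function using (_∘_)
open import Function.Bundles using (_⤖_; Bijection)
open import Function.Construct.Composition using (_⤖-∘_)
open import Function.Properties.Inverse using (↔⇒⤖)
open import Relation.Nullary using (yes; no)
open import Relation.Nullary.Decidable using (dec-true; dec-false)
open import Relation.Binary.PropositionalEquality
open ≡-Reasoning

odd : ℕ → Bool
odd a = a % 2 ≡ᵇ 1

≢-residues⇒xor≡true : ∀ {r s} → r < 2 → s < 2 → r ≢ s → (r ≡ᵇ 1) xor (s ≡ᵇ 1) ≡ true
≢-residues⇒xor≡true (s≤s z≤n)       (s≤s z≤n)       r≢s = ⊥-elim (r≢s refl)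
≢-residues⇒xor≡true (s≤s z≤n)       (s≤s (s≤s z≤n)) _   = refl
≢-residues⇒xor≡true (s≤s (s≤s z≤n)) (s≤s z≤n)       _   = refl
≢-residues⇒xor≡true (s≤s (s≤s z≤n)) (s≤s (s≤s z≤n)) r≢s = ⊥-elim (r≢s refl)

sameParity≡not-xor : ∀ a b → sameParity a b ≡ not (odd a xor odd b)
sameParity≡not-xor a b with a % 2 ℕ.≟ b % 2
... | yes a≡b = sym (begin
  not (odd a xor odd b) ≡⟨ cong (λ r → not ((r ≡ᵇ 1) xor odd b)) a≡b ⟩
  not (odd b xor odd b) ≡⟨ cong not (xor-same (odd b)) ⟩
  true                  ∎)
... | no a≢b = sym (cong not (≢-residues⇒xor≡true (m%n<n a 2) (m%n<n b 2) a≢b))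

not-xor≡false⇒≡not : ∀ a b → not (a xor b) ≡ false → b ≡ not a
not-xor≡false⇒≡not true  false _ = refl
not-xor≡false⇒≡not false true  _ = refl

toggle : {n : ℕ} → Fin n → (Fin n → Bool) → Fin n → Bool
toggle x π u = π u xor isVertex x u

switch-toggle : ∀ {n} (x : Fin n) {σ : Signature n} {π : Fin n → Bool} {u v : Fin n} →
                σ u v ≡ not (π u xor π v) →
                switch x σ u v ≡ not (toggle x π u xor toggle x π v)
switch-toggle x {σ} {π} {u} {v} σ-uv = begin
  (σ u v xor c) xor d               ≡⟨ cong (λ s → (s xor c) xor d) σ-uv ⟩
  (not (a xor b) xor c) xor d       ≡⟨ cong (_xor d) (sym (not-distribˡ-xor (a xor b) c)) ⟩
  not ((a xor b) xor c) xor d       ≡⟨ sym (not-distribˡ-xor ((a xor b) xor c) d) ⟩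
  not (((a xor b) xor c) xor d)     ≡⟨ cong not (xor-assoc (a xor b) c d) ⟩
  not ((a xor b) xor (c xor d))     ≡⟨ cong not (interchange a b c d) ⟩
  not ((a xor c) xor (b xor d))     ∎
  where
  a b c d : Bool
  a = π u
  b = π v
  c = isVertex x u
  d = isVertex x v

transpose-matchˡ : ∀ {n} (x y : Fin n) → transpose x y x ≡ y
transpose-matchˡ x y rewrite dec-true (x Fin.≟ x) refl = refl

transpose-matchʳ : ∀ {n} {x y : Fin n} → x ≢ y → transpose x y y ≡ x
transpose-matchʳ {x = x} {y} x≢y
  rewrite dec-false (y Fin.≟ x) (x≢y ∘ sym) | dec-true (y Fin.≟ y) refl = refl

transpose-other : ∀ {n} {x y u : Fin n} → x ≢ u → y ≢ u → transpose x y u ≡ u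
transpose-other {x = x} {y} {u} x≢u y≢u
  rewrite dec-false (u Fin.≟ x) (x≢u ∘ sym) | dec-false (u Fin.≟ y) (y≢u ∘ sym) = refl

xor-true : ∀ a → a xor true ≡ not a
xor-true a = trans (xor-comm a true) (true-xor a)

transpose-toggle : ∀ {n} (π : Fin n → Bool) {x y : Fin n} → π y ≡ not (π x) →
                   ∀ u → π (transpose x y u) ≡ toggle y (toggle x π) u
transpose-toggle π {x} {y} πy≡¬πx u with x Fin.≟ u | y Fin.≟ u
... | yes refl | yes refl = ⊥-elim (not-¬ refl πy≡¬πx)
... | yes refl | no _ = begin
  π (transpose x y x)    ≡⟨ cong π (transpose-matchˡ x y) ⟩
  π y                    ≡⟨ πy≡¬πx ⟩
  not (π x)              ≡⟨ sym (xor-true (π x)) ⟩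
  π x xor true           ≡⟨ sym (xor-identityʳ _) ⟩
  (π x xor true) xor false ∎
... | no x≢y | yes refl = begin
  π (transpose x y y)      ≡⟨ cong π (transpose-matchʳ x≢y) ⟩
  π x                      ≡⟨ sym (not-involutive (π x)) ⟩
  not (not (π x))          ≡⟨ cong not (sym πy≡¬πx) ⟩
  not (π y)                ≡⟨ sym (xor-true (π y)) ⟩
  π y xor true             ≡⟨ cong (_xor true) (sym (xor-identityʳ (π y))) ⟩
  (π y xor false) xor true ∎
... | no x≢u | no y≢u = begin
  π (transpose x y u)       ≡⟨ cong π (transpose-other x≢u y≢u) ⟩
  π u                       ≡⟨ sym (xor-identityʳ _) ⟩
  π u xor false             ≡⟨ sym (xor-identityʳ _) ⟩
  (π u xor false) xor false ∎

labelOdd : {n : ℕ} → (Fin n ⤖ Fin n) → Fin n → Bool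
labelOdd f u = odd (label (Bijection.to f u))

swapLabels : {n : ℕ} → (Fin n ⤖ Fin n) → Fin n → Fin n → (Fin n ⤖ Fin n)
swapLabels f x y = f ⤖-∘ ↔⇒⤖ (Perm.transpose x y)

swapLabels-isParityLabeling :
  ∀ {n} (G : Graph n) (σ : Signature n) (f : Fin n ⤖ Fin n) (x y : Fin n) →
  IsParityLabeling G σ f →
  sameParity (label (Bijection.to f x)) (label (Bijection.to f y)) ≡ false →
  IsParityLabeling G (switch y (switch x σ)) (swapLabels f x y)
swapLabels-isParityLabeling G σ f x y f-labels opposite {u} {v} uv = begin
  switch y (switch x σ) u v
    ≡⟨ switch-toggle y {switch x σ} {toggle x π} (switch-toggle x {σ} {π} σ-uv) ⟩
  not (toggle y (toggle x π) u xor toggle y (toggle x π) v)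
    ≡⟨ sym (cong₂ (λ p q → not (p xor q)) (swapped u) (swapped v)) ⟩
  not (π (transpose x y u) xor π (transpose x y v))
    ≡⟨ sym (sameParity≡not-xor _ _) ⟩
  sameParity (label (Bijection.to g u)) (label (Bijection.to g v)) ∎
  where
  π : Fin _ → Bool
  π = labelOdd f
  g : Fin _ ⤖ Fin _
  g = swapLabels f x y
  σ-uv : σ u v ≡ not (π u xor π v)
  σ-uv = trans (f-labels uv) (sameParity≡not-xor _ _)
  πy≡¬πx : π y ≡ not (π x)
  πy≡¬πx = not-xor≡false⇒≡not (π x) (π y) (trans (sym (sameParity≡not-xor _ _)) opposite)
  swapped : ∀ w → π (transpose x y w) ≡ toggle y (toggle x π) w
  swapped = transpose-toggle π πy≡¬πx

proposition2 : (n : ℕ) (G : Graph n) → Connected G →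
               (σ σ' : Signature n) → IsSignature G σ → IsSignature G σ' →
               IsParitySigned G σ → IsParitySwitchOf G σ σ' →
               IsParitySigned G σ'
proposition2 _ G _ σ σ' _ _ _ (f , f-labels , x , y , opposite , σ'≡switched) =
  swapLabels f x y , λ uv →
    trans (σ'≡switched uv) (swapLabels-isParityLabeling G σ f x y f-labels opposite uv)
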